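{- Let $S$ be a system of $m$ linear equations over $\mathrm{GF}(2)$ in variables $z_1,\dots,z_n$, where equation $e_j$ is $\sum_{i\in I_j}z_i=b_j$ with $\emptyset\neq I_j\subseteq\{1,\dots,n\}$, $b_j\in\{0,1\}$, and has positive integral weight $w_j$; suppose that $I_j\ne I_q$ for all $j\ne q$, and that no variable appears in more than $\rho$ equations, where $\rho\ge 2$. Let $\epsilon_1,\dots,\epsilon_n$ be independent random variables uniform on $\{ -1,1\}$ and $X=\sum_{j=1}^m (-1)^{b_j}w_j\prod_{i\in I_j}\epsilon_i$. Then $\mathbb{E}(X^4)\le 2\rho^2(\mathbb{E}(X^2))^2$. -}

module Defs where

open import Data.Bool using (Bool; true; false)
open import Data.Nat as ℕ using (ℕ; zero; suc)
open import Data.Fin using (Fin)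
import Data.Fin as Fin
open import Data.Vec using (Vec; []; _∷_; tabulate; lookup)
open import Data.Fin.Subset using (Subset; ∣_∣)
open import Data.Integer as ℤ using (ℤ; +_; -[1+_])
open import Data.Rational as ℚ using (ℚ; ½; _/_)

-- An assignment of the n random signs: ε_i = σ (lookup ε i).
-- σ false = +1, σ true = -1  (Bool ≅ GF(2), σ b = (-1)^b).
σ : Bool → ℤ
σ false = + 1
σ true  = -[1+ 0 ]

monomial : ∀ {n} → Subset n → Vec Bool n → ℤ
monomial [] [] = + 1
monomial (true ∷ I) (e ∷ ε) = σ e ℤ.* monomial I ε
monomial (false ∷ I) (e ∷ ε) = monomial I ε

sumFin : ∀ {m} → (Fin m → ℤ) → ℤ
sumFin {zero} f = + 0
sumFin {suc m} f = f Fin.zero ℤ.+ sumFin (λ j → f (Fin.suc j))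

X : ∀ {n m} → (Fin m → Subset n) → (Fin m → Bool) → (Fin m → ℕ) → Vec Bool n → ℤ
X I b w ε = sumFin (λ j → σ (b j) ℤ.* (+ w j) ℤ.* monomial (I j) ε)

𝔼 : ∀ n → (Vec Bool n → ℚ) → ℚ
𝔼 zero f = f []
𝔼 (suc n) f = ½ ℚ.* (𝔼 n (λ ε → f (false ∷ ε)) ℚ.+ 𝔼 n (λ ε → f (true ∷ ε)))

toℚ : ℤ → ℚ
toℚ z = z / 1

occurrences : ∀ {n m} → (Fin m → Subset n) → Fin n → ℕ
occurrences I i = ∣ tabulate (λ j → lookup (I j) i) ∣

-- Write X = ∑ⱼ cⱼ χ_{Iⱼ} with cⱼ = (-1)^{bⱼ} wⱼ and χ_S(ε) = ∏_{i∈S} εᵢ. The characters are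
-- orthonormal, 𝔼 (χ_S χ_T) = [S = T], and multiply by symmetric difference, χ_S χ_T = χ_{S Δ T}.
-- So 𝔼 X² = ∑ⱼ cⱼ² =: T since the Iⱼ are distinct, and
--   𝔼 X⁴ = ∑ cⱼ c_k c_{j′} c_{k′} [Iⱼ Δ I_k = I_{j′} Δ I_{k′}].
-- The terms with j = k force j′ = k′ and add up to T². For j ≠ k, AM-GM bounds the term by
-- ((cⱼ c_k)² + (c_{j′} c_{k′})²)/2, and at most 2ρ pairs (j′, k′) coincide with (j, k):
-- pick i ∈ Iⱼ Δ I_k; then i ∈ I_{j′} or i ∈ I_{k′}, and either index of the pair determines
-- the other. Hence 𝔼 X⁴ ≤ (1 + 2ρ) T² ≤ 2ρ² T².

module Submission where

open import Defs
open import Data.Bool using (Bool; true; false; _xor_; if_then_else_)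
import Data.Bool.Properties as BoolP
open import Data.Nat as ℕ using (ℕ; zero; suc)
import Data.Nat.Properties as ℕP
import Data.Nat.Tactic.RingSolver as ℕ-Solver
open import Data.Fin using (Fin; zero; suc)
import Data.Fin.Properties as FinP
open import Data.Fin.Subset using (Subset; ⊥; ∣_∣; Nonempty)
open import Data.Vec using (Vec; []; _∷_; lookup; tabulate; zipWith)
import Data.Vec.Properties as VecP
open import Data.Integer as ℤ using (ℤ; +_; -[1+_]; 0ℤ; 1ℤ; _+_; _*_; _-_; _^_; _≤_; +≤+)
open import Data.Integer.Properties
open import Data.Integer.Tactic.RingSolver using (solve-∀)
open import Data.Rational as ℚ using (ℚ; ½; 1ℚ)
import Data.Rational.Properties as ℚP
open import Data.Rational.Unnormalised as ℚᵘ using (mkℚᵘ; *≡*; *≤*)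
import Data.Rational.Unnormalised.Properties as ℚᵘP
open import Data.Rational.Solver using (module +-*-Solver)
open import Data.Product using (∃; _,_)
open import Function using (_∘_)
open import Function.Definitions using (Injective)
open import Level using (Level)
open import Relation.Nullary using (Dec; does; yes; no; ¬_; ¬?; contradiction; decidable-stable)
open import Relation.Binary.Definitions using (DecidableEquality)
open import Relation.Binary.PropositionalEquality
open import Algebra.Properties.CommutativeSemigroup *-commutativeSemigroup
  using () renaming (interchange to *-interchange; x∙yz≈y∙xz to x*[y*z]≡y*[x*z])
open import Algebra.Properties.Semiring.Sum +-*-semiring
  using (sum; sum-syntax; sum-cong-≗; sum-replicate-zero; ∑-distrib-+; ∑-comm; *-distribˡ-sum; *-distribʳ-sum)

private
  variable
    ℓ : Level
    A B C : Set ℓ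

⟦_⟧ : Dec A → ℤ
⟦ A? ⟧ = if does A? then 1ℤ else 0ℤ

⟦⟧-yes : (A? : Dec A) → A → ⟦ A? ⟧ ≡ 1ℤ
⟦⟧-yes (yes _) _ = refl
⟦⟧-yes (no ¬a) a = contradiction a ¬a

⟦⟧-no : (A? : Dec A) → ¬ A → ⟦ A? ⟧ ≡ 0ℤ
⟦⟧-no (yes a) ¬a = contradiction a ¬a
⟦⟧-no (no _)  _  = refl

⟦⟧-cong : (A? : Dec A) (B? : Dec B) → (A → B) → (B → A) → ⟦ A? ⟧ ≡ ⟦ B? ⟧
⟦⟧-cong A? (yes b) _   B→A = ⟦⟧-yes A? (B→A b)
⟦⟧-cong A? (no ¬b) A→B _   = ⟦⟧-no A? (¬b ∘ A→B)

⟦⟧*⟦⟧-congˡ : (A? : Dec A) (B? : Dec B) (C? : Dec C) →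
              (C → A → B) → (C → B → A) → ⟦ A? ⟧ * ⟦ C? ⟧ ≡ ⟦ B? ⟧ * ⟦ C? ⟧
⟦⟧*⟦⟧-congˡ A? B? (yes c) A→B B→A = cong (_* 1ℤ) (⟦⟧-cong A? B? (A→B c) (B→A c))
⟦⟧*⟦⟧-congˡ A? B? (no _)  _   _   = trans (*-zeroʳ ⟦ A? ⟧) (sym (*-zeroʳ ⟦ B? ⟧))

⟦⟧-nonNeg : (A? : Dec A) → 0ℤ ≤ ⟦ A? ⟧
⟦⟧-nonNeg (yes _) = +≤+ ℕ.z≤n
⟦⟧-nonNeg (no _)  = +≤+ ℕ.z≤n

⟦⟧+⟦¬⟧≡1 : (A? : Dec A) → ⟦ A? ⟧ + ⟦ ¬? A? ⟧ ≡ 1ℤ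
⟦⟧+⟦¬⟧≡1 (yes _) = refl
⟦⟧+⟦¬⟧≡1 (no _)  = refl

⟦⟧≤*⟦⟧ : (A? : Dec A) (y : ℤ) → (A → 1ℤ ≤ y) → ⟦ A? ⟧ ≤ y * ⟦ A? ⟧
⟦⟧≤*⟦⟧ (yes a) y 1≤y = ≤-trans (1≤y a) (≤-reflexive (sym (*-identityʳ y)))
⟦⟧≤*⟦⟧ (no _)  y _   = ≤-reflexive (sym (*-zeroʳ y))

x*x≥0 : ∀ x → 0ℤ ≤ x * x
x*x≥0 (+ n)    = subst (0ℤ ≤_) (pos-* n n) (+≤+ ℕ.z≤n)
x*x≥0 -[1+ n ] = +≤+ ℕ.z≤n

2xy≤x²+y² : ∀ x y → + 2 * (x * y) ≤ x * x + y * y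
2xy≤x²+y² x y = 0≤i-j⇒j≤i (subst (0ℤ ≤_) (square-of-difference x y) (x*x≥0 (x - y)))
  where
  square-of-difference : ∀ x y → (x - y) * (x - y) ≡ x * x + y * y - + 2 * (x * y)
  square-of-difference = solve-∀

x^2≡x*x : ∀ x → x ^ 2 ≡ x * x
x^2≡x*x x = cong (x *_) (*-identityʳ x)

x^4≡x²*x² : ∀ x → x ^ 4 ≡ (x * x) * (x * x)
x^4≡x²*x² = unfolded
  where
  unfolded : ∀ x → x * (x * (x * (x * 1ℤ))) ≡ (x * x) * (x * x)
  unfolded = solve-∀

1+2ρ≤2ρ² : ∀ {ρ} → 2 ℕ.≤ ρ → 1 ℕ.+ (ρ ℕ.+ ρ) ℕ.≤ 2 ℕ.* ρ ℕ.^ 2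
1+2ρ≤2ρ² {ρ} 2≤ρ = begin
  1 ℕ.+ (ρ ℕ.+ ρ)         ≤⟨ ℕP.+-monoˡ-≤ (ρ ℕ.+ ρ) 1≤ρ+ρ ⟩
  (ρ ℕ.+ ρ) ℕ.+ (ρ ℕ.+ ρ) ≡⟨ x+x≡x*2 (ρ ℕ.+ ρ) ⟩
  (ρ ℕ.+ ρ) ℕ.* 2         ≤⟨ ℕP.*-monoʳ-≤ (ρ ℕ.+ ρ) 2≤ρ ⟩
  (ρ ℕ.+ ρ) ℕ.* ρ         ≡⟨ [ρ+ρ]*ρ≡2*ρ² ρ ⟩
  2 ℕ.* ρ ℕ.^ 2           ∎
  where
  open ℕP.≤-Reasoning
  1≤ρ+ρ : 1 ℕ.≤ ρ ℕ.+ ρ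
  1≤ρ+ρ = ℕP.≤-trans (ℕP.≤-trans (ℕ.s≤s ℕ.z≤n) 2≤ρ) (ℕP.m≤m+n ρ ρ)
  x+x≡x*2 : ∀ x → x ℕ.+ x ≡ x ℕ.* 2
  x+x≡x*2 = ℕ-Solver.solve-∀
  [ρ+ρ]*ρ≡2*ρ² : ∀ ρ → (ρ ℕ.+ ρ) ℕ.* ρ ≡ 2 ℕ.* (ρ ℕ.* (ρ ℕ.* 1))
  [ρ+ρ]*ρ≡2*ρ² = ℕ-Solver.solve-∀

sumFin≡sum : ∀ {m} (f : Fin m → ℤ) → sumFin f ≡ sum f
sumFin≡sum {zero}  f = refl
sumFin≡sum {suc m} f = cong (_+_ (f zero)) (sumFin≡sum (f ∘ suc))

∑-mono-≤ : ∀ {m} {f g : Fin m → ℤ} → (∀ j → f j ≤ g j) → sum f ≤ sum g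
∑-mono-≤ {zero}  f≤g = ≤-refl
∑-mono-≤ {suc m} f≤g = +-mono-≤ (f≤g zero) (∑-mono-≤ (f≤g ∘ suc))

∑-*-∑ : ∀ {m p} (f : Fin m → ℤ) (g : Fin p → ℤ) → sum f * sum g ≡ ∑[ j < m ] ∑[ k < p ] (f j * g k)
∑-*-∑ f g = trans (*-distribʳ-sum (sum g) f) (sum-cong-≗ λ j → *-distribˡ-sum (f j) g)

∑-*-δ : ∀ {m} (j : Fin m) (f : Fin m → ℤ) → ∑[ k < m ] (f k * ⟦ j FinP.≟ k ⟧) ≡ f j
∑-*-δ {suc m} zero f = begin
  f zero * 1ℤ + ∑[ k < m ] (f (suc k) * 0ℤ)
    ≡⟨ cong₂ _+_ (*-identityʳ (f zero)) (sum-cong-≗ λ k → *-zeroʳ (f (suc k))) ⟩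
  f zero + ∑[ k < m ] 0ℤ
    ≡⟨ cong (_+_ (f zero)) (sum-replicate-zero m) ⟩
  f zero + 0ℤ
    ≡⟨ +-identityʳ (f zero) ⟩
  f zero ∎
  where open ≡-Reasoning
∑-*-δ {suc m} (suc j) f = begin
  f zero * 0ℤ + rest ≡⟨ cong (_+ rest) (*-zeroʳ (f zero)) ⟩
  0ℤ + rest          ≡⟨ +-identityˡ rest ⟩
  rest               ≡⟨ ∑-*-δ j (f ∘ suc) ⟩
  f (suc j)          ∎
  where
  open ≡-Reasoning
  rest = ∑[ k < m ] (f (suc k) * ⟦ j FinP.≟ k ⟧)

∑-*-≤ : ∀ {m} {a h : Fin m → ℤ} → (∀ j → 0ℤ ≤ a j) → (∀ j → h j ≤ 1ℤ) →
        ∑[ j < m ] (a j * h j) ≤ sum a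
∑-*-≤ {a = a} a≥0 h≤1 = ∑-mono-≤ λ j →
  ≤-trans (*-monoˡ-≤-nonNeg (a j) {{ℤ.nonNegative (a≥0 j)}} (h≤1 j)) (≤-reflexive (*-identityʳ (a j)))

∑⟦x≟f⟧≤1 : (_≟_ : DecidableEquality A) → ∀ {m} (f : Fin m → A) → Injective _≡_ _≡_ f →
           ∀ x → ∑[ k < m ] ⟦ x ≟ f k ⟧ ≤ 1ℤ
∑⟦x≟f⟧≤1 _≟_ {zero}  f f-injective x = +≤+ ℕ.z≤n
∑⟦x≟f⟧≤1 _≟_ {suc m} f f-injective x with x ≟ f zero
... | yes refl = ≤-reflexive (trans (cong (_+_ 1ℤ) rest≡0) (+-identityʳ 1ℤ))
  where
  rest≡0 : ∑[ k < m ] ⟦ f zero ≟ f (suc k) ⟧ ≡ 0ℤ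
  rest≡0 = trans (sum-cong-≗ λ k → ⟦⟧-no (f zero ≟ f (suc k)) (FinP.0≢1+n ∘ f-injective))
                 (sum-replicate-zero m)
... | no _ = ≤-trans (≤-reflexive (+-identityˡ _))
                     (∑⟦x≟f⟧≤1 _≟_ (f ∘ suc) (FinP.suc-injective ∘ f-injective) x)

∣tabulate∣≡∑ : ∀ {m} (f : Fin m → Bool) → + ∣ tabulate f ∣ ≡ ∑[ j < m ] ⟦ f j BoolP.≟ true ⟧
∣tabulate∣≡∑ {zero}  f = refl
∣tabulate∣≡∑ {suc m} f with f zero
... | true  = cong (_+_ 1ℤ) (∣tabulate∣≡∑ (f ∘ suc))
... | false = trans (∣tabulate∣≡∑ (f ∘ suc)) (sym (+-identityˡ _))

∑₂ : ∀ {m} → (Fin m → Fin m → ℤ) → ℤ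
∑₂ {m} F = ∑[ j < m ] ∑[ k < m ] F j k

module _ {m : ℕ} where

  ∑₂-cong : {F G : Fin m → Fin m → ℤ} → (∀ j k → F j k ≡ G j k) → ∑₂ F ≡ ∑₂ G
  ∑₂-cong F≡G = sum-cong-≗ λ j → sum-cong-≗ (F≡G j)

  ∑₂-mono-≤ : {F G : Fin m → Fin m → ℤ} → (∀ j k → F j k ≤ G j k) → ∑₂ F ≤ ∑₂ G
  ∑₂-mono-≤ F≤G = ∑-mono-≤ λ j → ∑-mono-≤ (F≤G j)

  ∑₂-distrib-+ : (F G : Fin m → Fin m → ℤ) → ∑₂ (λ j k → F j k + G j k) ≡ ∑₂ F + ∑₂ G
  ∑₂-distrib-+ F G = trans (sum-cong-≗ λ j → ∑-distrib-+ (F j) (G j))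
                           (∑-distrib-+ (λ j → sum (F j)) (λ j → sum (G j)))

  *-distribˡ-∑₂ : ∀ a (F : Fin m → Fin m → ℤ) → a * ∑₂ F ≡ ∑₂ (λ j k → a * F j k)
  *-distribˡ-∑₂ a F = trans (*-distribˡ-sum a (λ j → sum (F j))) (sum-cong-≗ λ j → *-distribˡ-sum a (F j))

  *-distribʳ-∑₂ : ∀ a (F : Fin m → Fin m → ℤ) → ∑₂ F * a ≡ ∑₂ (λ j k → F j k * a)
  *-distribʳ-∑₂ a F = trans (*-distribʳ-sum a (λ j → sum (F j))) (sum-cong-≗ λ j → *-distribʳ-sum a (F j))

  ∑₂-*-∑₂ : (F G : Fin m → Fin m → ℤ) → ∑₂ F * ∑₂ G ≡ ∑₂ λ j k → ∑₂ λ j′ k′ → F j k * G j′ k′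
  ∑₂-*-∑₂ F G = trans (*-distribʳ-∑₂ (∑₂ G) F) (∑₂-cong λ j k → *-distribˡ-∑₂ (F j k) G)

  ∑₂-*-δ : (f : Fin m → Fin m → ℤ) → ∑₂ (λ j k → f j k * ⟦ j FinP.≟ k ⟧) ≡ ∑[ j < m ] f j j
  ∑₂-*-δ f = sum-cong-≗ λ j → ∑-*-δ j (f j)

  ∑₂-comm : (F : Fin m → Fin m → Fin m → Fin m → ℤ) →
            ∑₂ (λ j k → ∑₂ (λ j′ k′ → F j k j′ k′)) ≡ ∑₂ (λ j′ k′ → ∑₂ (λ j k → F j k j′ k′))
  ∑₂-comm F = begin
    ∑[ j < m ] ∑[ k < m ] ∑[ j′ < m ] ∑[ k′ < m ] F j k j′ k′
      ≡⟨ sum-cong-≗ (λ j → ∑-comm λ k j′ → sum (F j k j′)) ⟩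
    ∑[ j < m ] ∑[ j′ < m ] ∑[ k < m ] ∑[ k′ < m ] F j k j′ k′
      ≡⟨ sum-cong-≗ (λ j → sum-cong-≗ λ j′ → ∑-comm λ k k′ → F j k j′ k′) ⟩
    ∑[ j < m ] ∑[ j′ < m ] ∑[ k′ < m ] ∑[ k < m ] F j k j′ k′
      ≡⟨ ∑-comm (λ j j′ → ∑[ k′ < m ] ∑[ k < m ] F j k j′ k′) ⟩
    ∑[ j′ < m ] ∑[ j < m ] ∑[ k′ < m ] ∑[ k < m ] F j k j′ k′
      ≡⟨ sum-cong-≗ (λ j′ → ∑-comm λ j k′ → ∑[ k < m ] F j k j′ k′) ⟩
    ∑[ j′ < m ] ∑[ k′ < m ] ∑[ j < m ] ∑[ k < m ] F j k j′ k′ ∎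
    where open ≡-Reasoning

infix 4 _≟ˢ_
_≟ˢ_ : ∀ {n} → DecidableEquality (Subset n)
_≟ˢ_ = VecP.≡-dec BoolP._≟_

infixl 6 _Δ_
_Δ_ : ∀ {n} → Subset n → Subset n → Subset n
_Δ_ = zipWith _xor_

Δ-self : ∀ {n} (S : Subset n) → S Δ S ≡ ⊥
Δ-self []      = refl
Δ-self (x ∷ S) = cong₂ _∷_ (BoolP.xor-same x) (Δ-self S)

module _ {n : ℕ} where

  Δ-comm : (S T : Subset n) → S Δ T ≡ T Δ S
  Δ-comm = VecP.zipWith-comm BoolP.xor-comm

  Δ-assoc : (S T U : Subset n) → S Δ T Δ U ≡ S Δ (T Δ U)
  Δ-assoc = VecP.zipWith-assoc BoolP.xor-assoc

  Δ-identityʳ : (S : Subset n) → S Δ ⊥ ≡ S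
  Δ-identityʳ = VecP.zipWith-identityʳ BoolP.xor-identityʳ

  Δ-cancelˡ : (S T : Subset n) → S Δ (S Δ T) ≡ T
  Δ-cancelˡ S T = begin
    S Δ (S Δ T) ≡⟨ Δ-assoc S S T ⟨
    S Δ S Δ T   ≡⟨ cong (_Δ T) (Δ-self S) ⟩
    ⊥ Δ T       ≡⟨ Δ-comm ⊥ T ⟩
    T Δ ⊥       ≡⟨ Δ-identityʳ T ⟩
    T           ∎
    where open ≡-Reasoning

  ≡Δ⇒Δ≡ : {S T U : Subset n} → U ≡ S Δ T → S Δ U ≡ T
  ≡Δ⇒Δ≡ {S} {T} refl = Δ-cancelˡ S T

  Δ≡⇒≡Δ : {S T U : Subset n} → S Δ U ≡ T → U ≡ S Δ T
  Δ≡⇒≡Δ {S} {U = U} refl = sym (Δ-cancelˡ S U)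

  Δ≡⊥⇒≡ : {S T : Subset n} → S Δ T ≡ ⊥ → S ≡ T
  Δ≡⊥⇒≡ {S} eq = sym (trans (Δ≡⇒≡Δ eq) (Δ-identityʳ S))

  lookup-Δ : (S T : Subset n) (i : Fin n) → lookup (S Δ T) i ≡ lookup S i xor lookup T i
  lookup-Δ S T i = VecP.lookup-zipWith _xor_ i S T

≢⇒∃Δ : ∀ {n} {S T : Subset n} → S ≢ T → ∃ λ i → lookup (S Δ T) i ≡ true
≢⇒∃Δ {S = []}        {[]}        S≢T = contradiction refl S≢T
≢⇒∃Δ {S = false ∷ S} {true ∷ T}  _   = zero , refl
≢⇒∃Δ {S = true ∷ S}  {false ∷ T} _   = zero , refl
≢⇒∃Δ {S = false ∷ S} {false ∷ T} S≢T with ≢⇒∃Δ (S≢T ∘ cong (false ∷_))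
... | i , i∈SΔT = suc i , i∈SΔT
≢⇒∃Δ {S = true ∷ S}  {true ∷ T}  S≢T with ≢⇒∃Δ (S≢T ∘ cong (true ∷_))
... | i , i∈SΔT = suc i , i∈SΔT

xor≡true⇒⟦⟧+⟦⟧≥1 : ∀ x y → x xor y ≡ true → 1ℤ ≤ ⟦ x BoolP.≟ true ⟧ + ⟦ y BoolP.≟ true ⟧
xor≡true⇒⟦⟧+⟦⟧≥1 true  false _ = ≤-refl
xor≡true⇒⟦⟧+⟦⟧≥1 false true  _ = ≤-refl
xor≡true⇒⟦⟧+⟦⟧≥1 true  true  ()
xor≡true⇒⟦⟧+⟦⟧≥1 false false ()

monomial-Δ : ∀ {n} (S T ε : Vec Bool n) → monomial S ε * monomial T ε ≡ monomial (S Δ T) ε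
monomial-Δ []          []          []      = refl
monomial-Δ (false ∷ S) (false ∷ T) (e ∷ ε) = monomial-Δ S T ε
monomial-Δ (true ∷ S)  (false ∷ T) (e ∷ ε) =
  trans (*-assoc (σ e) (monomial S ε) (monomial T ε)) (cong (σ e *_) (monomial-Δ S T ε))
monomial-Δ (false ∷ S) (true ∷ T)  (e ∷ ε) =
  trans (x*[y*z]≡y*[x*z] (monomial S ε) (σ e) (monomial T ε)) (cong (σ e *_) (monomial-Δ S T ε))
monomial-Δ (true ∷ S)  (true ∷ T)  (e ∷ ε) = begin
  (σ e * monomial S ε) * (σ e * monomial T ε) ≡⟨ *-interchange (σ e) (monomial S ε) (σ e) (monomial T ε) ⟩
  (σ e * σ e) * (monomial S ε * monomial T ε) ≡⟨ cong₂ _*_ (σ²≡1 e) (monomial-Δ S T ε) ⟩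
  1ℤ * monomial (S Δ T) ε                    ≡⟨ *-identityˡ (monomial (S Δ T) ε) ⟩
  monomial (S Δ T) ε                          ∎
  where
  open ≡-Reasoning
  σ²≡1 : ∀ e → σ e * σ e ≡ 1ℤ
  σ²≡1 false = refl
  σ²≡1 true  = refl

cubeSum : ∀ n → (Vec Bool n → ℤ) → ℤ
cubeSum zero    f = f []
cubeSum (suc n) f = cubeSum n (f ∘ (false ∷_)) + cubeSum n (f ∘ (true ∷_))

cubeSum-cong : ∀ {n} {f g : Vec Bool n → ℤ} → (∀ ε → f ε ≡ g ε) → cubeSum n f ≡ cubeSum n g
cubeSum-cong {zero}  f≗g = f≗g []
cubeSum-cong {suc n} f≗g = cong₂ _+_ (cubeSum-cong (f≗g ∘ (false ∷_))) (cubeSum-cong (f≗g ∘ (true ∷_)))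

*-distribˡ-cubeSum : ∀ {n} a (f : Vec Bool n → ℤ) → a * cubeSum n f ≡ cubeSum n (λ ε → a * f ε)
*-distribˡ-cubeSum {zero}  a f = refl
*-distribˡ-cubeSum {suc n} a f = trans (*-distribˡ-+ a _ _)
  (cong₂ _+_ (*-distribˡ-cubeSum a (f ∘ (false ∷_))) (*-distribˡ-cubeSum a (f ∘ (true ∷_))))

cubeSum-∑ : ∀ {n p} (f : Fin p → Vec Bool n → ℤ) →
            cubeSum n (λ ε → ∑[ j < p ] f j ε) ≡ ∑[ j < p ] cubeSum n (f j)
cubeSum-∑ {zero}  f = refl
cubeSum-∑ {suc n} f = trans
  (cong₂ _+_ (cubeSum-∑ (λ j → f j ∘ (false ∷_))) (cubeSum-∑ (λ j → f j ∘ (true ∷_))))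
  (sym (∑-distrib-+ (λ j → cubeSum n (f j ∘ (false ∷_))) (λ j → cubeSum n (f j ∘ (true ∷_)))))

-- f HasMean a encodes 𝔼 f = a through the cube sum 2ⁿ 𝔼 f, which keeps the moment
-- computations in ℤ.
infix 4 _HasMean_
record _HasMean_ {n} (f : Vec Bool n → ℤ) (a : ℤ) : Set where
  constructor mean≡
  field cubeSum≡ : cubeSum n f ≡ (+ 2) ^ n * a
open _HasMean_

module _ {n : ℕ} where

  mean-cong : ∀ {f g : Vec Bool n → ℤ} {a} → (∀ ε → f ε ≡ g ε) → f HasMean a → g HasMean a
  mean-cong f≗g (mean≡ f~a) = mean≡ (trans (sym (cubeSum-cong f≗g)) f~a)

  mean-*ˡ : ∀ {f : Vec Bool n → ℤ} {a} b → f HasMean a → (λ ε → b * f ε) HasMean b * a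
  mean-*ˡ {f} {a} b (mean≡ f~a) = mean≡ (begin
    cubeSum n (λ ε → b * f ε) ≡⟨ *-distribˡ-cubeSum b f ⟨
    b * cubeSum n f           ≡⟨ cong (b *_) f~a ⟩
    b * ((+ 2) ^ n * a)       ≡⟨ x*[y*z]≡y*[x*z] b ((+ 2) ^ n) a ⟩
    (+ 2) ^ n * (b * a)       ∎)
    where open ≡-Reasoning

  mean-∑ : ∀ {p} {f : Fin p → Vec Bool n → ℤ} {a : Fin p → ℤ} →
           (∀ j → f j HasMean a j) → (λ ε → ∑[ j < p ] f j ε) HasMean sum a
  mean-∑ {p} {f} {a} f~a = mean≡ (begin
    cubeSum n (λ ε → ∑[ j < p ] f j ε) ≡⟨ cubeSum-∑ f ⟩
    ∑[ j < p ] cubeSum n (f j)         ≡⟨ sum-cong-≗ (cubeSum≡ ∘ f~a) ⟩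
    ∑[ j < p ] ((+ 2) ^ n * a j)       ≡⟨ *-distribˡ-sum ((+ 2) ^ n) a ⟨
    (+ 2) ^ n * sum a                  ∎)
    where open ≡-Reasoning

  mean-∑₂ : ∀ {m} {F : Fin m → Fin m → Vec Bool n → ℤ} {a : Fin m → Fin m → ℤ} →
            (∀ j k → F j k HasMean a j k) → (λ ε → ∑₂ λ j k → F j k ε) HasMean ∑₂ a
  mean-∑₂ F~a = mean-∑ λ j → mean-∑ (F~a j)

  mean-even : ∀ (f : Vec Bool (suc n) → ℤ) {g a} → (∀ e ε → f (e ∷ ε) ≡ g ε) →
              g HasMean a → f HasMean a
  mean-even f {g} {a} f≗g g~a = mean≡ (begin
    cubeSum n (f ∘ (false ∷_)) + cubeSum n (f ∘ (true ∷_))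
      ≡⟨ cong₂ _+_ (cubeSum≡ (mean-cong (sym ∘ f≗g false) g~a)) (cubeSum≡ (mean-cong (sym ∘ f≗g true) g~a)) ⟩
    (+ 2) ^ n * a + (+ 2) ^ n * a
      ≡⟨ double ((+ 2) ^ n) a ⟩
    (+ 2) ^ suc n * a ∎)
    where
    open ≡-Reasoning
    double : ∀ x a → x * a + x * a ≡ + 2 * x * a
    double = solve-∀

  mean-odd : ∀ (f : Vec Bool (suc n) → ℤ) g → (∀ e ε → f (e ∷ ε) ≡ σ e * g ε) → f HasMean 0ℤ
  mean-odd f g f≗σg = mean≡ (begin
    cubeSum n (f ∘ (false ∷_)) + cubeSum n (f ∘ (true ∷_))
      ≡⟨ cong₂ _+_ (cubeSum-cong (f≗σg false)) (cubeSum-cong (f≗σg true)) ⟩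
    cubeSum n (λ ε → σ false * g ε) + cubeSum n (λ ε → σ true * g ε)
      ≡⟨ cong₂ _+_ (*-distribˡ-cubeSum (σ false) g) (*-distribˡ-cubeSum (σ true) g) ⟨
    σ false * cubeSum n g + σ true * cubeSum n g
      ≡⟨ *-distribʳ-+ (cubeSum n g) (σ false) (σ true) ⟨
    0ℤ * cubeSum n g
      ≡⟨ trans (*-zeroˡ (cubeSum n g)) (sym (*-zeroʳ ((+ 2) ^ suc n))) ⟩
    (+ 2) ^ suc n * 0ℤ ∎)
    where open ≡-Reasoning

mean-monomial : ∀ {n} (U : Subset n) → monomial U HasMean ⟦ U ≟ˢ ⊥ ⟧
mean-monomial []          = mean≡ refl
mean-monomial (false ∷ U) = mean-even (monomial (false ∷ U)) (λ _ _ → refl) (mean-monomial U)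
mean-monomial (true ∷ U)  = mean-odd (monomial (true ∷ U)) (monomial U) (λ _ _ → refl)

mean-monomial-* : ∀ {n} (S T : Subset n) → (λ ε → monomial S ε * monomial T ε) HasMean ⟦ S ≟ˢ T ⟧
mean-monomial-* S T = subst ((λ ε → monomial S ε * monomial T ε) HasMean_)
  (⟦⟧-cong (S Δ T ≟ˢ ⊥) (S ≟ˢ T) Δ≡⊥⇒≡ S≡T⇒Δ≡⊥)
  (mean-cong (sym ∘ monomial-Δ S T) (mean-monomial (S Δ T)))
  where
  S≡T⇒Δ≡⊥ : S ≡ T → S Δ T ≡ ⊥
  S≡T⇒Δ≡⊥ refl = Δ-self S

toℚᵘ∘toℚ : ∀ z → ℚ.toℚᵘ (toℚ z) ℚᵘ.≃ mkℚᵘ z 0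
toℚᵘ∘toℚ z = ℚP.toℚᵘ-fromℚᵘ (mkℚᵘ z 0)

toℚ-+ : ∀ x y → toℚ (x + y) ≡ toℚ x ℚ.+ toℚ y
toℚ-+ x y = ℚP.toℚᵘ-injective (begin
  ℚ.toℚᵘ (toℚ (x + y))                ≈⟨ toℚᵘ∘toℚ (x + y) ⟩
  mkℚᵘ (x + y) 0                      ≈⟨ *≡* (cong (_* 1ℤ) (cong₂ _+_ (sym (*-identityʳ x)) (sym (*-identityʳ y)))) ⟩
  mkℚᵘ x 0 ℚᵘ.+ mkℚᵘ y 0              ≈⟨ ℚᵘP.+-cong (toℚᵘ∘toℚ x) (toℚᵘ∘toℚ y) ⟨
  ℚ.toℚᵘ (toℚ x) ℚᵘ.+ ℚ.toℚᵘ (toℚ y)  ≈⟨ ℚP.toℚᵘ-homo-+ (toℚ x) (toℚ y) ⟨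
  ℚ.toℚᵘ (toℚ x ℚ.+ toℚ y)            ∎)
  where open ℚᵘP.≃-Reasoning

toℚ-* : ∀ x y → toℚ (x * y) ≡ toℚ x ℚ.* toℚ y
toℚ-* x y = ℚP.toℚᵘ-injective (begin
  ℚ.toℚᵘ (toℚ (x * y))                ≈⟨ toℚᵘ∘toℚ (x * y) ⟩
  mkℚᵘ x 0 ℚᵘ.* mkℚᵘ y 0              ≈⟨ ℚᵘP.*-cong (toℚᵘ∘toℚ x) (toℚᵘ∘toℚ y) ⟨
  ℚ.toℚᵘ (toℚ x) ℚᵘ.* ℚ.toℚᵘ (toℚ y)  ≈⟨ ℚP.toℚᵘ-homo-* (toℚ x) (toℚ y) ⟨
  ℚ.toℚᵘ (toℚ x ℚ.* toℚ y)            ∎)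
  where open ℚᵘP.≃-Reasoning

toℚ-mono-≤ : ∀ {x y} → x ≤ y → toℚ x ℚ.≤ toℚ y
toℚ-mono-≤ {x} {y} x≤y = ℚP.toℚᵘ-cancel-≤ (ℚᵘP.≤-respˡ-≃ (ℚᵘP.≃-sym (toℚᵘ∘toℚ x))
  (ℚᵘP.≤-respʳ-≃ (ℚᵘP.≃-sym (toℚᵘ∘toℚ y)) (*≤* (*-monoʳ-≤-nonNeg 1ℤ x≤y))))

½^ : ℕ → ℚ
½^ zero    = 1ℚ
½^ (suc n) = ½ ℚ.* ½^ n

𝔼≡cubeSum*½^ : ∀ n (f : Vec Bool n → ℤ) → 𝔼 n (toℚ ∘ f) ≡ toℚ (cubeSum n f) ℚ.* ½^ n
𝔼≡cubeSum*½^ zero    f = sym (ℚP.*-identityʳ (toℚ (f [])))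
𝔼≡cubeSum*½^ (suc n) f = begin
  ½ ℚ.* (𝔼 n (toℚ ∘ f₀) ℚ.+ 𝔼 n (toℚ ∘ f₁))
    ≡⟨ cong₂ (λ a b → ½ ℚ.* (a ℚ.+ b)) (𝔼≡cubeSum*½^ n f₀) (𝔼≡cubeSum*½^ n f₁) ⟩
  ½ ℚ.* (toℚ Σ₀ ℚ.* ½^ n ℚ.+ toℚ Σ₁ ℚ.* ½^ n)
    ≡⟨ solve 4 (λ h a b i → h :* (a :* i :+ b :* i) := (a :+ b) :* (h :* i)) refl ½ (toℚ Σ₀) (toℚ Σ₁) (½^ n) ⟩
  (toℚ Σ₀ ℚ.+ toℚ Σ₁) ℚ.* ½^ (suc n)
    ≡⟨ cong (ℚ._* ½^ (suc n)) (toℚ-+ Σ₀ Σ₁) ⟨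
  toℚ (Σ₀ + Σ₁) ℚ.* ½^ (suc n) ∎
  where
  open ≡-Reasoning
  open +-*-Solver
  f₀ f₁ : Vec Bool n → ℤ
  f₀ = f ∘ (false ∷_)
  f₁ = f ∘ (true ∷_)
  Σ₀ Σ₁ : ℤ
  Σ₀ = cubeSum n f₀
  Σ₁ = cubeSum n f₁

toℚ[2^n]*½^n≡1 : ∀ n → toℚ ((+ 2) ^ n) ℚ.* ½^ n ≡ 1ℚ
toℚ[2^n]*½^n≡1 zero    = refl
toℚ[2^n]*½^n≡1 (suc n) = begin
  toℚ (+ 2 * (+ 2) ^ n) ℚ.* (½ ℚ.* ½^ n)
    ≡⟨ cong (ℚ._* (½ ℚ.* ½^ n)) (toℚ-* (+ 2) ((+ 2) ^ n)) ⟩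
  toℚ (+ 2) ℚ.* toℚ ((+ 2) ^ n) ℚ.* (½ ℚ.* ½^ n)
    ≡⟨ solve 4 (λ a b h i → a :* b :* (h :* i) := a :* h :* (b :* i)) refl (toℚ (+ 2)) (toℚ ((+ 2) ^ n)) ½ (½^ n) ⟩
  toℚ (+ 2) ℚ.* ½ ℚ.* (toℚ ((+ 2) ^ n) ℚ.* ½^ n)
    ≡⟨ cong (1ℚ ℚ.*_) (toℚ[2^n]*½^n≡1 n) ⟩
  1ℚ ℚ.* 1ℚ ≡⟨⟩
  1ℚ        ∎
  where
  open ≡-Reasoning
  open +-*-Solver

𝔼-mean : ∀ {n} {f : Vec Bool n → ℤ} {a} → f HasMean a → 𝔼 n (toℚ ∘ f) ≡ toℚ a
𝔼-mean {n} {f} {a} (mean≡ f~a) = begin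
  𝔼 n (toℚ ∘ f)                        ≡⟨ 𝔼≡cubeSum*½^ n f ⟩
  toℚ (cubeSum n f) ℚ.* ½^ n           ≡⟨ cong (λ z → toℚ z ℚ.* ½^ n) f~a ⟩
  toℚ ((+ 2) ^ n * a) ℚ.* ½^ n         ≡⟨ cong (ℚ._* ½^ n) (toℚ-* ((+ 2) ^ n) a) ⟩
  toℚ ((+ 2) ^ n) ℚ.* toℚ a ℚ.* ½^ n
    ≡⟨ solve 3 (λ p a h → p :* a :* h := a :* (p :* h)) refl (toℚ ((+ 2) ^ n)) (toℚ a) (½^ n) ⟩
  toℚ a ℚ.* (toℚ ((+ 2) ^ n) ℚ.* ½^ n) ≡⟨ cong (toℚ a ℚ.*_) (toℚ[2^n]*½^n≡1 n) ⟩
  toℚ a ℚ.* 1ℚ                         ≡⟨ ℚP.*-identityʳ (toℚ a) ⟩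
  toℚ a                                ∎
  where
  open ≡-Reasoning
  open +-*-Solver

module CharacterSum {n m : ℕ} (I : Fin m → Subset n) (c : Fin m → ℤ) where

  χ : Fin m → Vec Bool n → ℤ
  χ j = monomial (I j)

  S : Vec Bool n → ℤ
  S ε = ∑[ j < m ] (c j * χ j ε)

  χΔ : Fin m → Fin m → Vec Bool n → ℤ
  χΔ j k = monomial (I j Δ I k)

  d : Fin m → Fin m → ℤ
  d j k = c j * c k

  S²-expansion : ∀ ε → S ε * S ε ≡ ∑₂ λ j k → d j k * (χ j ε * χ k ε)
  S²-expansion ε = trans (∑-*-∑ (λ j → c j * χ j ε) (λ k → c k * χ k ε))
                         (∑₂-cong λ j k → *-interchange (c j) (χ j ε) (c k) (χ k ε))

  mean-S² : (λ ε → S ε * S ε) HasMean ∑₂ (λ j k → d j k * ⟦ I j ≟ˢ I k ⟧)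
  mean-S² = mean-cong (sym ∘ S²-expansion)
    (mean-∑₂ λ j k → mean-*ˡ (d j k) (mean-monomial-* (I j) (I k)))

  S⁴-expansion : ∀ ε → (S ε * S ε) * (S ε * S ε) ≡
                 ∑₂ λ j k → ∑₂ λ j′ k′ → d j k * d j′ k′ * (χΔ j k ε * χΔ j′ k′ ε)
  S⁴-expansion ε = begin
    (S ε * S ε) * (S ε * S ε)
      ≡⟨ cong (λ x → x * x) (trans (S²-expansion ε) (∑₂-cong λ j k → cong (d j k *_) (monomial-Δ (I j) (I k) ε))) ⟩
    ∑₂ (λ j k → d j k * χΔ j k ε) * ∑₂ (λ j k → d j k * χΔ j k ε)
      ≡⟨ ∑₂-*-∑₂ (λ j k → d j k * χΔ j k ε) (λ j k → d j k * χΔ j k ε) ⟩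
    (∑₂ λ j k → ∑₂ λ j′ k′ → (d j k * χΔ j k ε) * (d j′ k′ * χΔ j′ k′ ε))
      ≡⟨ ∑₂-cong (λ j k → ∑₂-cong λ j′ k′ → *-interchange (d j k) (χΔ j k ε) (d j′ k′) (χΔ j′ k′ ε)) ⟩
    (∑₂ λ j k → ∑₂ λ j′ k′ → d j k * d j′ k′ * (χΔ j k ε * χΔ j′ k′ ε)) ∎
    where open ≡-Reasoning

  mean-S⁴ : (λ ε → (S ε * S ε) * (S ε * S ε)) HasMean
            ∑₂ λ j k → ∑₂ λ j′ k′ → d j k * d j′ k′ * ⟦ I j Δ I k ≟ˢ I j′ Δ I k′ ⟧
  mean-S⁴ = mean-cong (sym ∘ S⁴-expansion) (mean-∑₂ λ j k → mean-∑₂ λ j′ k′ →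
    mean-*ˡ (d j k * d j′ k′) (mean-monomial-* (I j Δ I k) (I j′ Δ I k′)))

module Coincidences {n m : ℕ} (I : Fin m → Subset n) (I-injective : Injective _≡_ _≡_ I) where

  Q : Fin m → Fin m → Subset n
  Q j k = I j Δ I k

  coincide : Fin m → Fin m → Fin m → Fin m → ℤ
  coincide j k j′ k′ = ⟦ Q j k ≟ˢ Q j′ k′ ⟧

  Q≡⊥⇒≡ : ∀ {j k} → Q j k ≡ ⊥ → j ≡ k
  Q≡⊥⇒≡ = I-injective ∘ Δ≡⊥⇒≡

  ≡⇒Q≡⊥ : ∀ {j k} → j ≡ k → Q j k ≡ ⊥
  ≡⇒Q≡⊥ {j} refl = Δ-self (I j)

  ∑₂-*-⟦I≟I⟧ : (f : Fin m → Fin m → ℤ) → ∑₂ (λ j k → f j k * ⟦ I j ≟ˢ I k ⟧) ≡ ∑[ j < m ] f j j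
  ∑₂-*-⟦I≟I⟧ f = trans (∑₂-cong λ j k → cong (f j k *_) (⟦I≟I⟧≡δ j k)) (∑₂-*-δ f)
    where
    ⟦I≟I⟧≡δ : ∀ j k → ⟦ I j ≟ˢ I k ⟧ ≡ ⟦ j FinP.≟ k ⟧
    ⟦I≟I⟧≡δ j k = ⟦⟧-cong (I j ≟ˢ I k) (j FinP.≟ k) I-injective (cong I)

  coincide-sym : ∀ j k j′ k′ → coincide j k j′ k′ ≡ coincide j′ k′ j k
  coincide-sym j k j′ k′ = ⟦⟧-cong (Q j k ≟ˢ Q j′ k′) (Q j′ k′ ≟ˢ Q j k) sym sym

  coincide-diag : ∀ j j′ k′ → coincide j j j′ k′ ≡ ⟦ j′ FinP.≟ k′ ⟧
  coincide-diag j j′ k′ = ⟦⟧-cong (Q j j ≟ˢ Q j′ k′) (j′ FinP.≟ k′)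
    (λ eq → Q≡⊥⇒≡ (trans (sym eq) (≡⇒Q≡⊥ refl)))
    (λ j′≡k′ → trans (≡⇒Q≡⊥ refl) (sym (≡⇒Q≡⊥ j′≡k′)))

  off-diagonal-coincide : ∀ j k j′ k′ → ⟦ ¬? (j FinP.≟ k) ⟧ * coincide j k j′ k′ ≡
                                        ⟦ ¬? (j′ FinP.≟ k′) ⟧ * coincide j k j′ k′
  off-diagonal-coincide j k j′ k′ = ⟦⟧*⟦⟧-congˡ (¬? (j FinP.≟ k)) (¬? (j′ FinP.≟ k′)) (Q j k ≟ˢ Q j′ k′)
    (λ eq j≢k j′≡k′ → j≢k (Q≡⊥⇒≡ (trans eq (≡⇒Q≡⊥ j′≡k′))))
    (λ eq j′≢k′ j≡k → j′≢k′ (Q≡⊥⇒≡ (trans (sym eq) (≡⇒Q≡⊥ j≡k))))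

  coincide-rows≤1 : ∀ j k j′ → ∑[ k′ < m ] coincide j k j′ k′ ≤ 1ℤ
  coincide-rows≤1 j k j′ = ≤-trans
    (≤-reflexive (sum-cong-≗ λ k′ →
      ⟦⟧-cong (Q j k ≟ˢ Q j′ k′) (I j′ Δ Q j k ≟ˢ I k′) ≡Δ⇒Δ≡ Δ≡⇒≡Δ))
    (∑⟦x≟f⟧≤1 _≟ˢ_ I I-injective (I j′ Δ Q j k))

  coincide-columns≤1 : ∀ j k k′ → ∑[ j′ < m ] coincide j k j′ k′ ≤ 1ℤ
  coincide-columns≤1 j k k′ = ≤-trans
    (≤-reflexive (sum-cong-≗ λ j′ → ⟦⟧-cong (Q j k ≟ˢ Q j′ k′) (Q j k ≟ˢ Q k′ j′)
                   (λ eq → trans eq (Δ-comm (I j′) (I k′))) (λ eq → trans eq (Δ-comm (I k′) (I j′)))))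
    (coincide-rows≤1 j k k′)

  ∑₂-coincide≤2ρ : (ρ : ℕ) → (∀ i → ∑[ j < m ] ⟦ lookup (I j) i BoolP.≟ true ⟧ ≤ + ρ) →
                   ∀ {j k} → j ≢ k → ∑₂ (coincide j k) ≤ + ρ + + ρ
  ∑₂-coincide≤2ρ ρ occurrences≤ρ {j} {k} j≢k with ≢⇒∃Δ (j≢k ∘ I-injective)
  ... | i , i∈Q = begin
    ∑₂ (coincide j k)
      ≤⟨ ∑₂-mono-≤ covered ⟩
    ∑₂ (λ j′ k′ → (a j′ + a k′) * e j′ k′)
      ≡⟨ ∑₂-cong (λ j′ k′ → *-distribʳ-+ (e j′ k′) (a j′) (a k′)) ⟩
    ∑₂ (λ j′ k′ → a j′ * e j′ k′ + a k′ * e j′ k′)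
      ≡⟨ ∑₂-distrib-+ (λ j′ k′ → a j′ * e j′ k′) (λ j′ k′ → a k′ * e j′ k′) ⟩
    ∑₂ (λ j′ k′ → a j′ * e j′ k′) + ∑₂ (λ j′ k′ → a k′ * e j′ k′)
      ≡⟨ cong (_+_ (∑₂ (λ j′ k′ → a j′ * e j′ k′))) (∑-comm λ j′ k′ → a k′ * e j′ k′) ⟩
    ∑₂ (λ j′ k′ → a j′ * e j′ k′) + ∑₂ (λ k′ j′ → a k′ * e j′ k′)
      ≤⟨ +-mono-≤ (weighted≤ρ e (coincide-rows≤1 j k))
                  (weighted≤ρ (λ k′ j′ → e j′ k′) (coincide-columns≤1 j k)) ⟩
    + ρ + + ρ ∎
    where
    open ≤-Reasoning
    e : Fin m → Fin m → ℤ
    e = coincide j k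

    a : Fin m → ℤ
    a x = ⟦ lookup (I x) i BoolP.≟ true ⟧

    covered : ∀ j′ k′ → e j′ k′ ≤ (a j′ + a k′) * e j′ k′
    covered j′ k′ = ⟦⟧≤*⟦⟧ (Q j k ≟ˢ Q j′ k′) (a j′ + a k′) λ eq →
      xor≡true⇒⟦⟧+⟦⟧≥1 (lookup (I j′) i) (lookup (I k′) i)
        (trans (sym (lookup-Δ (I j′) (I k′) i)) (trans (cong (λ U → lookup U i) (sym eq)) i∈Q))

    weighted≤ρ : (g : Fin m → Fin m → ℤ) → (∀ x → sum (g x) ≤ 1ℤ) → ∑₂ (λ x y → a x * g x y) ≤ + ρ
    weighted≤ρ g rows≤1 = begin
      ∑₂ (λ x y → a x * g x y)     ≡⟨ sum-cong-≗ (λ x → *-distribˡ-sum (a x) (g x)) ⟨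
      ∑[ x < m ] (a x * sum (g x)) ≤⟨ ∑-*-≤ (λ x → ⟦⟧-nonNeg (lookup (I x) i BoolP.≟ true)) rows≤1 ⟩
      sum a                        ≤⟨ occurrences≤ρ i ⟩
      + ρ                          ∎

module FourthMomentBound {n m : ℕ} (I : Fin m → Subset n) (I-injective : Injective _≡_ _≡_ I)
  (ρ : ℕ) (occurrences≤ρ : ∀ i → ∑[ j < m ] ⟦ lookup (I j) i BoolP.≟ true ⟧ ≤ + ρ)
  (c : Fin m → ℤ) where

  open Coincidences I I-injective
  open CharacterSum I c using (d)

  T : ℤ
  T = ∑[ j < m ] (c j * c j)

  t : Fin m → Fin m → Fin m → Fin m → ℤ
  t j k j′ k′ = d j k * d j′ k′ * coincide j k j′ k′

  K : ℤ
  K = ∑₂ λ j k → ∑₂ (t j k)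

  δ off : Fin m → Fin m → ℤ
  δ   j k = ⟦ j FinP.≟ k ⟧
  off j k = ⟦ ¬? (j FinP.≟ k) ⟧

  R : ℤ
  R = + ρ + + ρ

  K≡diagonal+offDiagonal : K ≡ ∑₂ (λ j k → ∑₂ (t j k) * δ j k) + ∑₂ (λ j k → ∑₂ (t j k) * off j k)
  K≡diagonal+offDiagonal = trans (∑₂-cong λ j k → split (∑₂ (t j k)) (j FinP.≟ k))
    (∑₂-distrib-+ (λ j k → ∑₂ (t j k) * δ j k) (λ j k → ∑₂ (t j k) * off j k))
    where
    split : ∀ x (A? : Dec A) → x ≡ x * ⟦ A? ⟧ + x * ⟦ ¬? A? ⟧
    split x A? = sym (trans (sym (*-distribˡ-+ x ⟦ A? ⟧ ⟦ ¬? A? ⟧))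
                            (trans (cong (x *_) (⟦⟧+⟦¬⟧≡1 A?)) (*-identityʳ x)))

  diagonal-part : ∑₂ (λ j k → ∑₂ (t j k) * δ j k) ≡ T * T
  diagonal-part = begin
    ∑₂ (λ j k → ∑₂ (t j k) * δ j k)
      ≡⟨ ∑₂-*-δ (λ j k → ∑₂ (t j k)) ⟩
    ∑[ j < m ] ∑₂ (t j j)
      ≡⟨ sum-cong-≗ (λ j → ∑₂-cong λ j′ k′ → cong (d j j * d j′ k′ *_) (coincide-diag j j′ k′)) ⟩
    ∑[ j < m ] ∑₂ (λ j′ k′ → d j j * d j′ k′ * δ j′ k′)
      ≡⟨ sum-cong-≗ (λ j → ∑₂-*-δ λ j′ k′ → d j j * d j′ k′) ⟩
    ∑[ j < m ] ∑[ j′ < m ] (d j j * d j′ j′)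
      ≡⟨ ∑-*-∑ (λ j → d j j) (λ j′ → d j′ j′) ⟨
    T * T ∎
    where open ≡-Reasoning

  ∑₂d²≡T² : ∑₂ (λ j k → d j k * d j k) ≡ T * T
  ∑₂d²≡T² = trans (∑₂-cong λ j k → *-interchange (c j) (c k) (c j) (c k))
                  (sym (∑-*-∑ (λ j → c j * c j) (λ k → c k * c k)))

  -- W j k j′ k′ is the share of the off-diagonal term t j k j′ k′ that AM-GM charges to (j, k).
  W : Fin m → Fin m → Fin m → Fin m → ℤ
  W j k j′ k′ = d j k * d j k * (off j k * coincide j k j′ k′)

  2t*off≤W+W : ∀ j k j′ k′ → + 2 * (t j k j′ k′ * off j k) ≤ W j k j′ k′ + W j′ k′ j k
  2t*off≤W+W j k j′ k′ = begin
    + 2 * (t j k j′ k′ * off j k)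
      ≡⟨ regroup (d j k) (d j′ k′) (coincide j k j′ k′) (off j k) ⟩
    + 2 * (d j k * d j′ k′) * ω
      ≤⟨ *-monoʳ-≤-nonNeg ω {{ℤ.nonNegative ω≥0}} (2xy≤x²+y² (d j k) (d j′ k′)) ⟩
    (d j k * d j k + d j′ k′ * d j′ k′) * ω
      ≡⟨ *-distribʳ-+ ω (d j k * d j k) (d j′ k′ * d j′ k′) ⟩
    W j k j′ k′ + d j′ k′ * d j′ k′ * ω
      ≡⟨ cong (λ x → W j k j′ k′ + d j′ k′ * d j′ k′ * x)
              (trans (off-diagonal-coincide j k j′ k′) (cong (off j′ k′ *_) (coincide-sym j k j′ k′))) ⟩
    W j k j′ k′ + W j′ k′ j k ∎
    where
    open ≤-Reasoning
    ω : ℤ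
    ω = off j k * coincide j k j′ k′
    ω≥0 : 0ℤ ≤ ω
    ω≥0 = subst (_≤ ω) (*-zeroʳ (off j k))
      (*-monoˡ-≤-nonNeg (off j k) {{ℤ.nonNegative (⟦⟧-nonNeg (¬? (j FinP.≟ k)))}}
                        (⟦⟧-nonNeg (Q j k ≟ˢ Q j′ k′)))
    regroup : ∀ x y e o → + 2 * (x * y * e * o) ≡ + 2 * (x * y) * (o * e)
    regroup = solve-∀

  off*∑₂coincide≤R : ∀ j k → off j k * ∑₂ (coincide j k) ≤ R
  off*∑₂coincide≤R j k with j FinP.≟ k
  ... | yes _  = +≤+ ℕ.z≤n
  ... | no j≢k = ≤-trans (≤-reflexive (*-identityˡ _)) (∑₂-coincide≤2ρ ρ occurrences≤ρ j≢k)

  ∑₂∑₂W≤R*T² : ∑₂ (λ j k → ∑₂ (W j k)) ≤ R * (T * T)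
  ∑₂∑₂W≤R*T² = begin
    ∑₂ (λ j k → ∑₂ (W j k))
      ≡⟨ ∑₂-cong (λ j k → factor (d j k * d j k) (off j k) (coincide j k)) ⟩
    ∑₂ (λ j k → d j k * d j k * (off j k * ∑₂ (coincide j k)))
      ≤⟨ ∑₂-mono-≤ (λ j k → *-monoˡ-≤-nonNeg (d j k * d j k) {{ℤ.nonNegative (x*x≥0 (d j k))}}
                                              (off*∑₂coincide≤R j k)) ⟩
    ∑₂ (λ j k → d j k * d j k * R)
      ≡⟨ *-distribʳ-∑₂ R (λ j k → d j k * d j k) ⟨
    ∑₂ (λ j k → d j k * d j k) * R
      ≡⟨ cong (_* R) ∑₂d²≡T² ⟩
    T * T * R
      ≡⟨ *-comm (T * T) R ⟩
    R * (T * T) ∎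
    where
    open ≤-Reasoning
    factor : ∀ x y (F : Fin m → Fin m → ℤ) → ∑₂ (λ j′ k′ → x * (y * F j′ k′)) ≡ x * (y * ∑₂ F)
    factor x y F = begin-equality
      ∑₂ (λ j′ k′ → x * (y * F j′ k′)) ≡⟨ ∑₂-cong (λ j′ k′ → *-assoc x y (F j′ k′)) ⟨
      ∑₂ (λ j′ k′ → x * y * F j′ k′)   ≡⟨ *-distribˡ-∑₂ (x * y) F ⟨
      x * y * ∑₂ F                     ≡⟨ *-assoc x y (∑₂ F) ⟩
      x * (y * ∑₂ F)                   ∎

  off-diagonal-part : ∑₂ (λ j k → ∑₂ (t j k) * off j k) ≤ R * (T * T)
  off-diagonal-part = *-cancelˡ-≤-pos _ _ (+ 2) (begin
    + 2 * ∑₂ (λ j k → ∑₂ (t j k) * off j k)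
      ≡⟨ distribute ⟩
    ∑₂ (λ j k → ∑₂ λ j′ k′ → + 2 * (t j k j′ k′ * off j k))
      ≤⟨ ∑₂-mono-≤ (λ j k → ∑₂-mono-≤ (2t*off≤W+W j k)) ⟩
    ∑₂ (λ j k → ∑₂ λ j′ k′ → W j k j′ k′ + W j′ k′ j k)
      ≡⟨ trans (∑₂-cong λ j k → ∑₂-distrib-+ (W j k) (λ j′ k′ → W j′ k′ j k))
               (∑₂-distrib-+ (λ j k → ∑₂ (W j k)) (λ j k → ∑₂ λ j′ k′ → W j′ k′ j k)) ⟩
    ∑₂ (λ j k → ∑₂ (W j k)) + ∑₂ (λ j k → ∑₂ λ j′ k′ → W j′ k′ j k)
      ≡⟨ cong (_+_ (∑₂ (λ j k → ∑₂ (W j k)))) (∑₂-comm (λ j k j′ k′ → W j′ k′ j k)) ⟩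
    ∑₂ (λ j k → ∑₂ (W j k)) + ∑₂ (λ j k → ∑₂ (W j k))
      ≤⟨ +-mono-≤ ∑₂∑₂W≤R*T² ∑₂∑₂W≤R*T² ⟩
    R * (T * T) + R * (T * T)
      ≡⟨ double (R * (T * T)) ⟩
    + 2 * (R * (T * T)) ∎)
    where
    open ≤-Reasoning
    distribute : + 2 * ∑₂ (λ j k → ∑₂ (t j k) * off j k) ≡
                 ∑₂ (λ j k → ∑₂ λ j′ k′ → + 2 * (t j k j′ k′ * off j k))
    distribute = trans (*-distribˡ-∑₂ (+ 2) (λ j k → ∑₂ (t j k) * off j k)) (∑₂-cong λ j k →
      trans (cong (+ 2 *_) (*-distribʳ-∑₂ (off j k) (t j k)))
            (*-distribˡ-∑₂ (+ 2) (λ j′ k′ → t j k j′ k′ * off j k)))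
    double : ∀ x → x + x ≡ + 2 * x
    double = solve-∀

  K≤[1+R]T² : K ≤ (1ℤ + R) * (T * T)
  K≤[1+R]T² = begin
    K
      ≡⟨ K≡diagonal+offDiagonal ⟩
    ∑₂ (λ j k → ∑₂ (t j k) * δ j k) + ∑₂ (λ j k → ∑₂ (t j k) * off j k)
      ≤⟨ +-mono-≤ (≤-reflexive diagonal-part) off-diagonal-part ⟩
    T * T + R * (T * T)
      ≡⟨ cong (_+ R * (T * T)) (*-identityˡ (T * T)) ⟨
    1ℤ * (T * T) + R * (T * T)
      ≡⟨ *-distribʳ-+ (T * T) 1ℤ R ⟨
    (1ℤ + R) * (T * T) ∎
    where open ≤-Reasoning

lemma7 : (n m ρ : ℕ) (I : Fin m → Subset n) (b : Fin m → Bool) (w : Fin m → ℕ) →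
         (∀ j → Nonempty (I j)) →
         (∀ j → 1 ℕ.≤ w j) →
         (∀ j q → j ≢ q → I j ≢ I q) →
         (∀ i → occurrences I i ℕ.≤ ρ) →
         2 ℕ.≤ ρ →
         𝔼 n (λ ε → toℚ (X I b w ε ℤ.^ 4))
           ℚ.≤ toℚ (+ (2 ℕ.* ρ ℕ.^ 2)) ℚ.* (𝔼 n (λ ε → toℚ (X I b w ε ℤ.^ 2)) ℚ.* 𝔼 n (λ ε → toℚ (X I b w ε ℤ.^ 2)))
lemma7 n m ρ I b w _ _ distinct occurrences≤ρ 2≤ρ = begin
  𝔼 n (λ ε → toℚ (X I b w ε ^ 4))     ≡⟨ 𝔼-mean mean-X⁴ ⟩
  toℚ K                                ≤⟨ toℚ-mono-≤ K≤2ρ²T² ⟩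
  toℚ (2ρ² * (T * T))                  ≡⟨ trans (toℚ-* 2ρ² (T * T)) (cong (toℚ 2ρ² ℚ.*_) (toℚ-* T T)) ⟩
  toℚ 2ρ² ℚ.* (toℚ T ℚ.* toℚ T)        ≡⟨ cong (λ x → toℚ 2ρ² ℚ.* (x ℚ.* x)) (𝔼-mean mean-X²) ⟨
  toℚ 2ρ² ℚ.* (𝔼 n (λ ε → toℚ (X I b w ε ^ 2)) ℚ.* 𝔼 n (λ ε → toℚ (X I b w ε ^ 2))) ∎
  where
  open ℚP.≤-Reasoning
  c : Fin m → ℤ
  c j = σ (b j) * + w j
  I-injective : Injective _≡_ _≡_ I
  I-injective {j} {q} Ij≡Iq = decidable-stable (j FinP.≟ q) (λ j≢q → distinct j q j≢q Ij≡Iq)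
  occurrences≤ρ′ : ∀ i → ∑[ j < m ] ⟦ lookup (I j) i BoolP.≟ true ⟧ ≤ + ρ
  occurrences≤ρ′ i = subst (_≤ + ρ) (∣tabulate∣≡∑ (λ j → lookup (I j) i)) (+≤+ (occurrences≤ρ i))
  open CharacterSum I c using (S; d; mean-S²; mean-S⁴)
  open Coincidences I I-injective using (∑₂-*-⟦I≟I⟧)
  open FourthMomentBound I I-injective ρ occurrences≤ρ′ c using (T; K; K≤[1+R]T²)
  2ρ² : ℤ
  2ρ² = + (2 ℕ.* ρ ℕ.^ 2)
  X≡S : ∀ ε → X I b w ε ≡ S ε
  X≡S ε = sumFin≡sum (λ j → c j * monomial (I j) ε)
  S²≡X^2 : ∀ ε → S ε * S ε ≡ X I b w ε ^ 2
  S²≡X^2 ε = sym (trans (x^2≡x*x (X I b w ε)) (cong (λ x → x * x) (X≡S ε)))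
  S⁴≡X^4 : ∀ ε → (S ε * S ε) * (S ε * S ε) ≡ X I b w ε ^ 4
  S⁴≡X^4 ε = sym (trans (x^4≡x²*x² (X I b w ε)) (cong (λ x → (x * x) * (x * x)) (X≡S ε)))
  mean-X² : (λ ε → X I b w ε ^ 2) HasMean T
  mean-X² = subst ((λ ε → X I b w ε ^ 2) HasMean_) (∑₂-*-⟦I≟I⟧ d) (mean-cong S²≡X^2 mean-S²)
  mean-X⁴ : (λ ε → X I b w ε ^ 4) HasMean K
  mean-X⁴ = mean-cong S⁴≡X^4 mean-S⁴
  K≤2ρ²T² : K ≤ 2ρ² * (T * T)
  K≤2ρ²T² = ≤-trans K≤[1+R]T²
    (*-monoʳ-≤-nonNeg (T * T) {{ℤ.nonNegative (x*x≥0 T)}} (+≤+ (1+2ρ≤2ρ² 2≤ρ)))
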